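{- Let $n\ge 1$. The set $\mathcal{M}_n$ of magog triangles of size $n$ is in bijection with the set $\mathcal{K}_n$ of kagog triangles of index $n$.
   Context: A magog triangle of size $n$ is an array of positive integers $M(i,j)$, $1\le j\le i\le n$, such that $1\le M(i,j)\le j$; $M(i,j)\le M(i+1,j)$ whenever both are defined; and $M(i,j)\le M(i,j+1)$ whenever both are defined. $\mathcal{M}_n$ denotes the set of these. A kagog triangle of index $n$ is an array of nonnegative integers $K(i,j)$, $1\le j\le i\le n-1$ (the empty array when $n=1$), such that: $0\le K(i,j)\le j$; $K(i,j)\ge K(i+1,j)$ whenever both are defined; and if $K(i,j)>0$ and $j<i$ then $K(i,j+1)>K(i,j)$. $\mathcal{K}_n$ denotes the set of these. -}

module Defs where

open import Data.Nat using (ℕ; zero; suc; _≤_; _<_; _∸_; _+_; _≡ᵇ_)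
open import Data.Bool using (if_then_else_)
open import Data.Unit using (⊤)
open import Data.Product using (_×_; Σ)
open import Data.Vec using (Vec; []; _∷_)

-- A triangular array of naturals with n rows; row i (1-based) has i entries.
-- Tri (suc n) = (first n rows , row n+1).
Tri : ℕ → Set
Tri zero = ⊤
Tri (suc n) = Tri n × Vec ℕ (suc n)

-- 1-based lookup in a vector, default 0 out of range.
getV : ∀ {k} → Vec ℕ k → ℕ → ℕ
getV [] _ = 0
getV (x ∷ xs) 0 = 0
getV (x ∷ xs) 1 = x
getV (x ∷ xs) (suc (suc j)) = getV xs (suc j)

-- entry T i j = T(i,j) (1-based), 0 outside the triangle.
entry : ∀ {n} → Tri n → ℕ → ℕ → ℕ
entry {zero} _ i j = 0
entry {suc n} (t Data.Product., r) i j = if i ≡ᵇ suc n then getV r j else entry t i j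

IsMagog : (n : ℕ) → Tri n → Set
IsMagog n M =
  (∀ i j → 1 ≤ j → j ≤ i → i ≤ n → 1 ≤ entry M i j × entry M i j ≤ j)
  × (∀ i j → 1 ≤ j → j ≤ i → suc i ≤ n → entry M i j ≤ entry M (suc i) j)
  × (∀ i j → 1 ≤ j → suc j ≤ i → i ≤ n → entry M i j ≤ entry M i (suc j))

IsKagog : (n : ℕ) → Tri (n ∸ 1) → Set
IsKagog n K =
  (∀ i j → 1 ≤ j → j ≤ i → i ≤ n ∸ 1 → entry K i j ≤ j)
  × (∀ i j → 1 ≤ j → j ≤ i → suc i ≤ n ∸ 1 → entry K (suc i) j ≤ entry K i j)
  × (∀ i j → 1 ≤ j → j < i → i ≤ n ∸ 1 → 0 < entry K i j → entry K i j < entry K i (suc j))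

Magog : ℕ → Set
Magog n = Σ (Tri n) (IsMagog n)

Kagog : ℕ → Set
Kagog n = Σ (Tri (n ∸ 1)) (IsKagog n)

-- Column c of a magog triangle of size N, read downwards from the diagonal, is a weakly
-- increasing sequence of N+1−c values in [1, c]; column q = N+1−c of a kagog triangle is a
-- weakly decreasing sequence of c−1 values in [0, q].  Conjugation (record, for each
-- threshold, how many entries lie below it, as for the conjugate of a partition) is a
-- bijection between these two kinds of column; concretely K(p,q) is the number of entries of
-- magog column N+1−q that are at most N−p.  Under this column-wise correspondence the magog
-- condition M(i,c) ≤ M(i,c+1) linking adjacent columns becomes exactly the kagog condition
-- K(p,q) > 0 ⇒ K(p,q) < K(p,q+1).

module Submission where

open import Data.Bool using (Bool; true; false; not; T; if_then_else_)
open import Data.Bool.Properties using (not-involutive)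
open import Data.Empty using (⊥; ⊥-elim)
open import Data.Nat
open import Data.Nat.Properties
open import Data.Product using (Σ; _×_; _,_; proj₁; proj₂)
open import Data.Sum using (inj₁; inj₂)
open import Data.Vec using (Vec; []; _∷_)
open import Function using (_∘_)
open import Relation.Binary.Core using (Rel)
open import Relation.Binary.Definitions using (Reflexive; Transitive)
open import Relation.Binary.PropositionalEquality
open import Relation.Nullary.Reflects using (det; fromEquivalence)

open import Defs

count : (ℕ → Bool) → ℕ → ℕ
count P zero    = 0
count P (suc l) = if P 0 then suc (count (P ∘ suc) l) else count (P ∘ suc) l

count-≤ : ∀ P l → count P l ≤ l
count-≤ P zero = z≤n
count-≤ P (suc l) with P 0
... | true  = s≤s (count-≤ (P ∘ suc) l)
... | false = m≤n⇒m≤1+n (count-≤ (P ∘ suc) l)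

count-mono : ∀ P Q l → (∀ r → r < l → T (P r) → T (Q r)) → count P l ≤ count Q l
count-mono P Q zero    P⇒Q = z≤n
count-mono P Q (suc l) P⇒Q
  with P 0 | Q 0 | P⇒Q 0 z<s | count-mono (P ∘ suc) (Q ∘ suc) l (λ r → P⇒Q (suc r) ∘ s<s)
... | true  | true  | _     | tail = s≤s tail
... | true  | false | P0⇒Q0 | _    = ⊥-elim (P0⇒Q0 _)
... | false | true  | _     | tail = m≤n⇒m≤1+n tail
... | false | false | _     | tail = tail

count-cong : ∀ P Q l → (∀ r → r < l → P r ≡ Q r) → count P l ≡ count Q l
count-cong P Q l P≡Q = ≤-antisym
  (count-mono P Q l (λ r r<l → subst T (P≡Q r r<l)))
  (count-mono Q P l (λ r r<l → subst T (sym (P≡Q r r<l))))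

count-shift-≤ : ∀ P Q l → (∀ r → r < l → T (P r) → T (Q (suc r))) → count P l ≤ count Q (suc l)
count-shift-≤ P Q l P⇒Q with Q 0
... | true  = m≤n⇒m≤1+n (count-mono P (Q ∘ suc) l P⇒Q)
... | false = count-mono P (Q ∘ suc) l P⇒Q

count-shift-< : ∀ P Q l → T (Q 0) → (∀ r → r < l → T (P r) → T (Q (suc r))) →
  count P l < count Q (suc l)
count-shift-< P Q l Q0 P⇒Q with Q 0
... | true = s≤s (count-mono P (Q ∘ suc) l P⇒Q)

count-complement : ∀ P l → count P l + count (not ∘ P) l ≡ l
count-complement P zero = refl
count-complement P (suc l) with P 0
... | true  = cong suc (count-complement (P ∘ suc) l)
... | false = trans (+-suc _ _) (cong suc (count-complement (P ∘ suc) l))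

count-initialSegment : ∀ P l N → (∀ r → r < l → P r ≡ (r <ᵇ N)) → N ≤ l → count P l ≡ N
count-initialSegment P zero    .zero   P≡ z≤n = refl
count-initialSegment P (suc l) zero    P≡ _
  rewrite P≡ 0 z<s = count-initialSegment (P ∘ suc) l zero (λ r → P≡ (suc r) ∘ s<s) z≤n
count-initialSegment P (suc l) (suc N) P≡ (s≤s N≤l)
  rewrite P≡ 0 z<s = cong suc (count-initialSegment (P ∘ suc) l N (λ r → P≡ (suc r) ∘ s<s) N≤l)

¬T⇒≡false : ∀ {b} → (T b → ⊥) → b ≡ false
¬T⇒≡false {true}  ¬b = ⊥-elim (¬b _)
¬T⇒≡false {false} _  = refl

T-not-contrapositive : ∀ {a b} → (T a → T b) → T (not b) → T (not a)
T-not-contrapositive {true}  {true}  _ ()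
T-not-contrapositive {true}  {false} a⇒b _ = a⇒b _
T-not-contrapositive {false}         _   _ = _

<ᵇ-suc : ∀ m n → (m <ᵇ suc n) ≡ (m ≤ᵇ n)
<ᵇ-suc zero    n = refl
<ᵇ-suc (suc m) n = refl

≤ᵇ≡not<ᵇ : ∀ m n → (m ≤ᵇ n) ≡ not (n <ᵇ m)
≤ᵇ≡not<ᵇ zero    n       = refl
≤ᵇ≡not<ᵇ (suc m) zero    = refl
≤ᵇ≡not<ᵇ (suc m) (suc n) = trans (<ᵇ-suc m n) (≤ᵇ≡not<ᵇ m n)

<ᵇ≡not≤ᵇ : ∀ m n → (m <ᵇ n) ≡ not (n ≤ᵇ m)
<ᵇ≡not≤ᵇ m n = trans (sym (not-involutive (m <ᵇ n))) (cong not (sym (≤ᵇ≡not<ᵇ n m)))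

DownClosedBelow : ℕ → (ℕ → Bool) → Set
DownClosedBelow l P = ∀ {r r'} → r ≤ r' → r' < l → T (P r') → T (P r)

UpClosedBelow : ℕ → (ℕ → Bool) → Set
UpClosedBelow l P = ∀ {r r'} → r ≤ r' → r' < l → T (P r) → T (P r')

count-downClosed : ∀ P l → DownClosedBelow l P → ∀ r → r < l → P r ≡ (r <ᵇ count P l)
count-downClosed P (suc l) down r r<l with P 0 in P0
... | false = trans (allFalse r r<l) (cong (r <ᵇ_) (sym
  (count-initialSegment (P ∘ suc) l 0 (λ r' → allFalse (suc r') ∘ s<s) z≤n)))
  where
  allFalse : ∀ r → r < suc l → P r ≡ false
  allFalse r r<l = ¬T⇒≡false (λ Pr → subst T P0 (down z≤n r<l Pr))
count-downClosed P (suc l) down zero    _         | true = P0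
count-downClosed P (suc l) down (suc r) (s<s r<l) | true =
  count-downClosed (P ∘ suc) l (λ r≤r' → down (s≤s r≤r') ∘ s<s) r r<l

count-upClosed : ∀ P l → UpClosedBelow l P → ∀ r → r < l → P r ≡ (l ∸ count P l ≤ᵇ r)
count-upClosed P l up r r<l = begin
  P r                              ≡⟨ sym (not-involutive (P r)) ⟩
  not (not (P r))                  ≡⟨ cong not (count-downClosed (not ∘ P) l notDown r r<l) ⟩
  not (r <ᵇ count (not ∘ P) l)     ≡⟨ cong (λ c → not (r <ᵇ c)) countNot ⟩
  not (r <ᵇ (l ∸ count P l))       ≡⟨ sym (≤ᵇ≡not<ᵇ (l ∸ count P l) r) ⟩
  (l ∸ count P l ≤ᵇ r)             ∎
  where
  open ≡-Reasoning
  notDown : DownClosedBelow l (not ∘ P)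
  notDown r≤r' r'<l = T-not-contrapositive (up r≤r' r'<l)
  countNot : count (not ∘ P) l ≡ l ∸ count P l
  countNot = trans (sym (m+n∸m≡n (count P l) _)) (cong (_∸ count P l) (count-complement P l))

count-finalSegment : ∀ P l b → (∀ r → r < l → P r ≡ (b ≤ᵇ r)) → b ≤ l → count P l ≡ l ∸ b
count-finalSegment P l b P≡ b≤l = begin
  count P l                                   ≡⟨ sym (m+n∸n≡m (count P l) b) ⟩
  count P l + b ∸ b                           ≡⟨ cong (λ c → count P l + c ∸ b) (sym countNot) ⟩
  count P l + count (not ∘ P) l ∸ b           ≡⟨ cong (_∸ b) (count-complement P l) ⟩
  l ∸ b                                       ∎
  where
  open ≡-Reasoning
  countNot : count (not ∘ P) l ≡ b
  countNot = count-initialSegment (not ∘ P) l b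
    (λ r r<l → trans (cong not (P≡ r r<l)) (sym (<ᵇ≡not≤ᵇ r b))) b≤l

<∸⇒+< : ∀ a s L → a < L ∸ s → a + s < L
<∸⇒+< a zero    L       a<L   = subst (_< L) (sym (+-identityʳ a)) a<L
<∸⇒+< a (suc s) (suc L) a<L∸s = subst (_< suc L) (sym (+-suc a s)) (s<s (<∸⇒+< a s L a<L∸s))

<∸-comm : ∀ a s L → a < L ∸ s → s < L ∸ a
<∸-comm a s L a<L∸s = m+n≤o⇒m≤o∸n (suc s) (subst (_< L) (+-comm a s) (<∸⇒+< a s L a<L∸s))

<ᵇ-∸-comm : ∀ a s L → (a <ᵇ L ∸ s) ≡ (s <ᵇ L ∸ a)
<ᵇ-∸-comm a s L = det (<ᵇ-reflects-< a (L ∸ s))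
  (fromEquivalence (<∸-comm s a L ∘ <ᵇ⇒< s (L ∸ a)) (<⇒<ᵇ ∘ <∸-comm a s L))

stepwise⇒related : ∀ {a ℓ} {A : Set a} {_∼_ : Rel A ℓ} → Reflexive _∼_ → Transitive _∼_ →
  ∀ (x : ℕ → A) n → (∀ z → suc z < n → x z ∼ x (suc z)) →
  ∀ {r r'} → r ≤ r' → r' < n → x r ∼ x r'
stepwise⇒related {_∼_ = _∼_} ∼-refl ∼-trans x n step {r' = zero}    z≤n _ = ∼-refl
stepwise⇒related {_∼_ = _∼_} ∼-refl ∼-trans x n step {r' = suc r'} r≤1+r' 1+r'<n
  with m≤n⇒m<n∨m≡n r≤1+r'
... | inj₁ (s≤s r≤r') = ∼-trans
  (stepwise⇒related {_∼_ = _∼_} ∼-refl ∼-trans x n step r≤r' (<-trans (n<1+n r') 1+r'<n))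
  (step r' 1+r'<n)
... | inj₂ refl = ∼-refl

MonotoneBelow : ℕ → (ℕ → ℕ) → Set
MonotoneBelow n x = ∀ {r r'} → r ≤ r' → r' < n → x r ≤ x r'

AntitoneBelow : ℕ → (ℕ → ℕ) → Set
AntitoneBelow n x = ∀ {r r'} → r ≤ r' → r' < n → x r' ≤ x r

stepwise⇒monotone : ∀ x n → (∀ z → suc z < n → x z ≤ x (suc z)) → MonotoneBelow n x
stepwise⇒monotone = stepwise⇒related {_∼_ = _≤_} ≤-refl ≤-trans

stepwise⇒antitone : ∀ x n → (∀ z → suc z < n → x (suc z) ≤ x z) → AntitoneBelow n x
stepwise⇒antitone = stepwise⇒related {_∼_ = _≥_} ≤-refl (λ p q → ≤-trans q p)

countAtMost : (ℕ → ℕ) → ℕ → ℕ → ℕ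
countAtMost x n t = count (λ r → x r ≤ᵇ t) n

countAtMost-mono : ∀ x n {t t'} → t ≤ t' → countAtMost x n t ≤ countAtMost x n t'
countAtMost-mono x n {t} {t'} t≤t' =
  count-mono _ _ n (λ r _ xr≤t → ≤⇒≤ᵇ (≤-trans (≤ᵇ⇒≤ (x r) t xr≤t) t≤t'))

countAtMost-conjugate-increasing : ∀ a q L →
  (∀ r → r < q → 1 ≤ a r × a r ≤ suc L) → MonotoneBelow q a →
  ∀ r → r < q → suc (countAtMost (λ s → countAtMost a q (L ∸ s)) L r) ≡ a r
countAtMost-conjugate-increasing a q L bounds mono r r<q with a r in ar | bounds r r<q
... | suc a' | _ , s≤s a'≤L =
  cong suc (trans (count-finalSegment _ L (L ∸ a') threshold≡ (m∸n≤m L a')) (m∸[m∸n]≡n a'≤L))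
  where
  open ≡-Reasoning
  threshold≡ : ∀ s → s < L → (countAtMost a q (L ∸ s) ≤ᵇ r) ≡ (L ∸ a' ≤ᵇ s)
  threshold≡ s _ = begin
    (countAtMost a q (L ∸ s) ≤ᵇ r)        ≡⟨ ≤ᵇ≡not<ᵇ (countAtMost a q (L ∸ s)) r ⟩
    not (r <ᵇ countAtMost a q (L ∸ s))    ≡⟨ cong not (sym (count-downClosed _ q down r r<q)) ⟩
    not (a r ≤ᵇ L ∸ s)                    ≡⟨ cong (λ v → not (v ≤ᵇ L ∸ s)) ar ⟩
    not (a' <ᵇ L ∸ s)                     ≡⟨ cong not (<ᵇ-∸-comm a' s L) ⟩
    not (s <ᵇ L ∸ a')                     ≡⟨ sym (≤ᵇ≡not<ᵇ (L ∸ a') s) ⟩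
    (L ∸ a' ≤ᵇ s)                         ∎
    where
    down : DownClosedBelow q (λ r' → a r' ≤ᵇ L ∸ s)
    down {r' = r₁} r₀≤r₁ r₁<q ar₁≤ = ≤⇒≤ᵇ (≤-trans (mono r₀≤r₁ r₁<q) (≤ᵇ⇒≤ (a r₁) (L ∸ s) ar₁≤))

countAtMost-conjugate-decreasing : ∀ b q L → (∀ s → s < L → b s ≤ q) → AntitoneBelow L b →
  ∀ s → s < L → countAtMost (λ r → suc (countAtMost b L r)) q (L ∸ s) ≡ b s
countAtMost-conjugate-decreasing b q L bound anti s s<L =
  count-initialSegment _ q (b s) below-b≡ (bound s s<L)
  where
  open ≡-Reasoning
  below-b≡ : ∀ r → r < q → (suc (countAtMost b L r) ≤ᵇ L ∸ s) ≡ (r <ᵇ b s)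
  below-b≡ r _ = begin
    (countAtMost b L r <ᵇ L ∸ s)           ≡⟨ <ᵇ-∸-comm _ s L ⟩
    (s <ᵇ L ∸ countAtMost b L r)           ≡⟨ <ᵇ≡not≤ᵇ s (L ∸ countAtMost b L r) ⟩
    not (L ∸ countAtMost b L r ≤ᵇ s)       ≡⟨ cong not (sym (count-upClosed _ L up s s<L)) ⟩
    not (b s ≤ᵇ r)                         ≡⟨ sym (<ᵇ≡not≤ᵇ r (b s)) ⟩
    (r <ᵇ b s)                             ∎
    where
    up : UpClosedBelow L (λ s' → b s' ≤ᵇ r)
    up {s₀} s₀≤s₁ s₁<L bs₀≤r = ≤⇒≤ᵇ (≤-trans (anti s₀≤s₁ s₁<L) (≤ᵇ⇒≤ (b s₀) r bs₀≤r))

rowFrom : (ℕ → ℕ) → ℕ → (l : ℕ) → Vec ℕ l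
rowFrom f s zero    = []
rowFrom f s (suc l) = f s ∷ rowFrom f (suc s) l

getV-rowFrom : ∀ f s l j → j < l → getV (rowFrom f s l) (suc j) ≡ f (s + j)
getV-rowFrom f s (suc l) zero    _         = cong f (sym (+-identityʳ s))
getV-rowFrom f s (suc l) (suc j) (s<s j<l) =
  trans (getV-rowFrom f (suc s) l j j<l) (cong f (sym (+-suc s j)))

rowFrom-≡ : ∀ f s l (v : Vec ℕ l) → (∀ j → j < l → f (s + j) ≡ getV v (suc j)) →
  rowFrom f s l ≡ v
rowFrom-≡ f s zero    []       _ = refl
rowFrom-≡ f s (suc l) (x ∷ xs) f≡v =
  cong₂ _∷_ (trans (cong f (sym (+-identityʳ s))) (f≡v 0 z<s))
    (rowFrom-≡ f (suc s) l xs (λ j j<l → trans (cong f (sym (+-suc s j))) (f≡v (suc j) (s<s j<l))))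

triangle : ∀ n → (ℕ → ℕ → ℕ) → Tri n
triangle zero    F = _
triangle (suc n) F = triangle n F , rowFrom (F (suc n)) 1 (suc n)

entry-init : ∀ {n} (t : Tri n) (v : Vec ℕ (suc n)) i j → i ≤ n →
  entry {suc n} (t , v) i j ≡ entry t i j
entry-init {n} t v i j i≤n rewrite ¬T⇒≡false (<⇒≢ (s≤s i≤n) ∘ ≡ᵇ⇒≡ i (suc n)) = refl

entry-last : ∀ {n} (t : Tri n) (v : Vec ℕ (suc n)) j → entry {suc n} (t , v) (suc n) j ≡ getV v j
entry-last {n} t v j with suc n ≡ᵇ suc n in eq
... | true  = refl
... | false = ⊥-elim (subst T eq (≡⇒≡ᵇ (suc n) (suc n) refl))

entry-triangle : ∀ n F i j → 1 ≤ j → j ≤ i → i ≤ n → entry (triangle n F) i j ≡ F i j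
entry-triangle zero    F .zero   (suc j) _ () z≤n
entry-triangle (suc n) F i       (suc j) _ 1+j≤i i≤1+n with m≤n⇒m<n∨m≡n i≤1+n
... | inj₁ (s≤s i≤n) = trans (entry-init (triangle n F) (rowFrom (F (suc n)) 1 (suc n)) i (suc j) i≤n)
                             (entry-triangle n F i (suc j) (s≤s z≤n) 1+j≤i i≤n)
... | inj₂ refl      = trans (entry-last (triangle n F) (rowFrom (F (suc n)) 1 (suc n)) (suc j))
                             (getV-rowFrom (F (suc n)) 1 (suc n) j 1+j≤i)

triangle-≡ : ∀ n F (t : Tri n) → (∀ i j → 1 ≤ j → j ≤ i → i ≤ n → F i j ≡ entry t i j) →
  triangle n F ≡ t
triangle-≡ zero    F _       _   = refl
triangle-≡ (suc n) F (t , v) F≡t = cong₂ _,_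
  (triangle-≡ n F t (λ i j 1≤j j≤i i≤n →
    trans (F≡t i j 1≤j j≤i (m≤n⇒m≤1+n i≤n)) (entry-init t v i j i≤n)))
  (rowFrom-≡ (F (suc n)) 1 (suc n) v (λ j j<1+n →
    trans (F≡t (suc n) (suc j) (s≤s z≤n) j<1+n ≤-refl) (entry-last t v (suc j))))

column : (ℕ → ℕ → ℕ) → ℕ → ℕ → ℕ
column T c r = T (r + c) c

mirror : ℕ → ℕ → ℕ
mirror N c = suc (N ∸ c)

mirror-involutive : ∀ N c → 1 ≤ c → c ≤ N → mirror N (mirror N c) ≡ c
mirror-involutive N (suc c) _ c≤N =
  cong suc (trans (sym (pred[m∸n]≡m∸[1+n] N (N ∸ suc c))) (cong pred (m∸[m∸n]≡n c≤N)))

mirror-suc : ∀ N j → j < N → mirror N j ≡ suc (mirror N (suc j))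
mirror-suc (suc N) zero    _         = refl
mirror-suc (suc N) (suc j) (s<s j<N) = mirror-suc N j j<N

mirror+≡ : ∀ N c → c ≤ N → mirror N c + c ≡ suc N
mirror+≡ N c c≤N = cong suc (m∸n+n≡m c≤N)

+mirror-suc≡ : ∀ N j → j < N → j + mirror N (suc j) ≡ N
+mirror-suc≡ N j j<N = trans (+-suc j (N ∸ suc j)) (m+[n∸m]≡n j<N)

∸-mirror : ∀ N c → 1 ≤ c → c ≤ N → N ∸ mirror N c ≡ pred c
∸-mirror N c 1≤c c≤N = cong pred (mirror-involutive N c 1≤c c≤N)

columnRow≤ : ∀ {r l c n} → r < l → l + c ≤ suc n → r + c ≤ n
columnRow≤ {c = c} r<l l+c≤ = ≤-pred (≤-trans (+-monoˡ-≤ c r<l) l+c≤)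

module MagogColumns {n} (M : Tri n) (magog : IsMagog n M) where

  m : ℕ → ℕ → ℕ
  m = entry M

  bounded : ∀ c l → 1 ≤ c → l + c ≤ suc n → ∀ r → r < l → 1 ≤ column m c r × column m c r ≤ c
  bounded c l 1≤c l+c≤ r r<l = proj₁ magog (r + c) c 1≤c (m≤n+m c r) (columnRow≤ r<l l+c≤)

  monotone : ∀ c l → 1 ≤ c → l + c ≤ suc n → MonotoneBelow l (column m c)
  monotone c l 1≤c l+c≤ = stepwise⇒monotone (column m c) l (λ z 1+z<l →
    proj₁ (proj₂ magog) (z + c) c 1≤c (m≤n+m c z) (columnRow≤ 1+z<l l+c≤))

  countAtMost-adjacent-< : ∀ c j t → 1 ≤ c → j + c ≤ n →
    0 < countAtMost (column m (suc c)) j t →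
    countAtMost (column m (suc c)) j t < countAtMost (column m c) (suc j) t
  countAtMost-adjacent-< c j t 1≤c j+c≤n pos =
    count-shift-< (λ r → column m (suc c) r ≤ᵇ t) (λ r → column m c r ≤ᵇ t) j diagonal shift
    where
    j+1+c≤ : j + suc c ≤ suc n
    j+1+c≤ = subst (_≤ suc n) (sym (+-suc j c)) (s≤s j+c≤n)
    0<j : 0 < j
    0<j = <-≤-trans pos (count-≤ _ j)
    1+c≤n : suc c ≤ n
    1+c≤n = ≤-trans (+-monoˡ-≤ c 0<j) j+c≤n
    first≤t : T (m (suc c) (suc c) ≤ᵇ t)
    first≤t = subst T (sym (count-downClosed _ j down 0 0<j)) (<⇒<ᵇ pos)
      where
      down : DownClosedBelow j (λ r → column m (suc c) r ≤ᵇ t)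
      down r₀≤r₁ r₁<j ≤t =
        ≤⇒≤ᵇ (≤-trans (monotone (suc c) j (s≤s z≤n) j+1+c≤ r₀≤r₁ r₁<j) (≤ᵇ⇒≤ _ t ≤t))
    diagonal : T (m c c ≤ᵇ t)
    diagonal = ≤⇒≤ᵇ (≤-trans (≤-trans
      (proj₁ (proj₂ magog) c c 1≤c ≤-refl 1+c≤n)
      (proj₂ (proj₂ magog) (suc c) c 1≤c ≤-refl 1+c≤n))
      (≤ᵇ⇒≤ _ t first≤t))
    shift : ∀ r → r < j → T (column m (suc c) r ≤ᵇ t) → T (column m c (suc r) ≤ᵇ t)
    shift r r<j ≤t = ≤⇒≤ᵇ (≤-trans
      (proj₂ (proj₂ magog) (suc (r + c)) c 1≤c (s≤s (m≤n+m c r)) (columnRow≤ (s≤s r<j) (s≤s j+c≤n)))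
      (subst (λ i → m i (suc c) ≤ t) (+-suc r c) (≤ᵇ⇒≤ _ t ≤t)))

module KagogColumns {n} (K : Tri n) (kagog : IsKagog (suc n) K) where

  k : ℕ → ℕ → ℕ
  k = entry K

  bounded : ∀ q l → 1 ≤ q → l + q ≤ suc n → ∀ s → s < l → column k q s ≤ q
  bounded q l 1≤q l+q≤ s s<l = proj₁ kagog (s + q) q 1≤q (m≤n+m q s) (columnRow≤ s<l l+q≤)

  antitone : ∀ q l → 1 ≤ q → l + q ≤ suc n → AntitoneBelow l (column k q)
  antitone q l 1≤q l+q≤ = stepwise⇒antitone (column k q) l (λ z 1+z<l →
    proj₁ (proj₂ kagog) (z + q) q 1≤q (m≤n+m q z) (columnRow≤ 1+z<l l+q≤))

  countAtMost-adjacent-≤ : ∀ q l x → 1 ≤ q → suc l + q ≤ suc n →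
    countAtMost (column k (suc q)) l x ≤ countAtMost (column k q) (suc l) (pred x)
  countAtMost-adjacent-≤ q l x 1≤q 1+l+q≤ =
    count-shift-≤ (λ s → column k (suc q) s ≤ᵇ x) (λ s → column k q s ≤ᵇ pred x) l shift
    where
    shift : ∀ s → s < l → T (column k (suc q) s ≤ᵇ x) → T (column k q (suc s) ≤ᵇ pred x)
    shift s s<l ≤x = ≤⇒≤ᵇ (strict (k p q) refl)
      where
      p = suc (s + q)
      p≤n : p ≤ n
      p≤n = columnRow≤ (s≤s s<l) 1+l+q≤
      next≤x : k p (suc q) ≤ x
      next≤x = subst (λ i → k i (suc q) ≤ x) (+-suc s q) (≤ᵇ⇒≤ _ x ≤x)
      strict : ∀ v → k p q ≡ v → k p q ≤ pred x
      strict zero    kpq≡0 = subst (_≤ pred x) (sym kpq≡0) z≤n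
      strict (suc v) kpq≡ = <⇒≤pred (≤-trans
        (proj₂ (proj₂ kagog) p q 1≤q (s≤s (m≤n+m q s)) p≤n (subst (0 <_) (sym kpq≡) z<s)) next≤x)

kagogOf : ℕ → (ℕ → ℕ → ℕ) → ℕ → ℕ → ℕ
kagogOf N m p q = countAtMost (column m (mirror N q)) q (N ∸ p)

magogOf : ℕ → (ℕ → ℕ → ℕ) → ℕ → ℕ → ℕ
magogOf N k i c = suc (countAtMost (column k (mirror N c)) (c ∸ 1) (i ∸ c))

kagogOf-isKagog : ∀ {n} (M : Tri (suc n)) → IsMagog (suc n) M →
  IsKagog (suc n) (triangle n (kagogOf (suc n) (entry M)))
kagogOf-isKagog {n} M magog = atMostColumn , antitoneColumns , strictRows
  where
  N = suc n
  m = entry M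
  K = kagogOf N m
  atMostColumn : ∀ i j → 1 ≤ j → j ≤ i → i ≤ n → entry (triangle n K) i j ≤ j
  atMostColumn i j 1≤j j≤i i≤n rewrite entry-triangle n K i j 1≤j j≤i i≤n = count-≤ _ j
  antitoneColumns : ∀ i j → 1 ≤ j → j ≤ i → suc i ≤ n →
    entry (triangle n K) (suc i) j ≤ entry (triangle n K) i j
  antitoneColumns i j 1≤j j≤i 1+i≤n
    rewrite entry-triangle n K (suc i) j 1≤j (m≤n⇒m≤1+n j≤i) 1+i≤n
          | entry-triangle n K i j 1≤j j≤i (<⇒≤ 1+i≤n)
    = countAtMost-mono (column m (mirror N j)) j (∸-monoʳ-≤ N (n≤1+n i))
  strictRows : ∀ i j → 1 ≤ j → j < i → i ≤ n → 0 < entry (triangle n K) i j →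
    entry (triangle n K) i j < entry (triangle n K) i (suc j)
  strictRows i j 1≤j j<i i≤n pos
    rewrite entry-triangle n K i j 1≤j (<⇒≤ j<i) i≤n
          | entry-triangle n K i (suc j) (s≤s z≤n) j<i i≤n
    = subst (λ c → countAtMost (column m c) j (N ∸ i) < K i (suc j)) (sym mirror-j)
        (MagogColumns.countAtMost-adjacent-< M magog (mirror N (suc j)) j (N ∸ i) (s≤s z≤n)
          (≤-reflexive (+mirror-suc≡ N j j<N))
          (subst (λ c → 0 < countAtMost (column m c) j (N ∸ i)) mirror-j pos))
    where
    j<N : j < N
    j<N = <-≤-trans j<i (m≤n⇒m≤1+n i≤n)
    mirror-j : mirror N j ≡ suc (mirror N (suc j))
    mirror-j = mirror-suc N j j<N

magogOf-isMagog : ∀ {n} (K : Tri n) → IsKagog (suc n) K →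
  IsMagog (suc n) (triangle (suc n) (magogOf (suc n) (entry K)))
magogOf-isMagog {n} K kagog = bounded , monotoneColumns , monotoneRows
  where
  N = suc n
  k = entry K
  M = magogOf N k
  bounded : ∀ i c → 1 ≤ c → c ≤ i → i ≤ N →
    1 ≤ entry (triangle N M) i c × entry (triangle N M) i c ≤ c
  bounded i (suc L) 1≤c c≤i i≤N
    rewrite entry-triangle N M i (suc L) 1≤c c≤i i≤N = s≤s z≤n , s≤s (count-≤ _ L)
  monotoneColumns : ∀ i c → 1 ≤ c → c ≤ i → suc i ≤ N →
    entry (triangle N M) i c ≤ entry (triangle N M) (suc i) c
  monotoneColumns i c 1≤c c≤i 1+i≤N
    rewrite entry-triangle N M i c 1≤c c≤i (<⇒≤ 1+i≤N)
          | entry-triangle N M (suc i) c 1≤c (m≤n⇒m≤1+n c≤i) 1+i≤N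
    = s≤s (countAtMost-mono (column k (mirror N c)) (c ∸ 1) (∸-monoˡ-≤ c (n≤1+n i)))
  monotoneRows : ∀ i c → 1 ≤ c → suc c ≤ i → i ≤ N →
    entry (triangle N M) i c ≤ entry (triangle N M) i (suc c)
  monotoneRows i c@(suc L) 1≤c c<i i≤N
    rewrite entry-triangle N M i c 1≤c (<⇒≤ c<i) i≤N
          | entry-triangle N M i (suc c) (s≤s z≤n) c<i i≤N
          | mirror-suc N c (<-≤-trans c<i i≤N)
          | sym (pred[m∸n]≡m∸[1+n] i c)
    = s≤s (KagogColumns.countAtMost-adjacent-≤ K kagog (mirror N (suc c)) L (i ∸ c) (s≤s z≤n)
             (≤-reflexive (+mirror-suc≡ N c (<-≤-trans c<i i≤N))))

magogOf-kagogOf : ∀ {n} (M : Tri (suc n)) → IsMagog (suc n) M →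
  ∀ i c → 1 ≤ c → c ≤ i → i ≤ suc n →
  magogOf (suc n) (entry (triangle n (kagogOf (suc n) (entry M)))) i c ≡ entry M i c
magogOf-kagogOf {n} M magog i c@(suc L) 1≤c c≤i i≤N = begin
  suc (countAtMost (column k q) L (i ∸ c))
    ≡⟨ cong suc (count-cong _ _ L (λ s s<L → cong (_≤ᵇ i ∸ c) (kagogColumn s s<L))) ⟩
  suc (countAtMost (λ s → countAtMost (column m c) q (L ∸ s)) L (i ∸ c))
    ≡⟨ countAtMost-conjugate-increasing (column m c) q L
         (MagogColumns.bounded M magog c q 1≤c q+c≤) (MagogColumns.monotone M magog c q 1≤c q+c≤)
         (i ∸ c) (s≤s (∸-monoˡ-≤ c i≤N)) ⟩
  m (i ∸ c + c) c
    ≡⟨ cong (λ r → m r c) (m∸n+n≡m c≤i) ⟩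
  m i c ∎
  where
  open ≡-Reasoning
  N = suc n
  m = entry M
  k = entry (triangle n (kagogOf N m))
  q = mirror N c
  c≤N = ≤-trans c≤i i≤N
  q+c≤ : q + c ≤ suc N
  q+c≤ = ≤-reflexive (mirror+≡ N c c≤N)
  kagogColumn : ∀ s → s < L → column k q s ≡ countAtMost (column m c) q (L ∸ s)
  kagogColumn s s<L = begin
    k (s + q) q
      ≡⟨ entry-triangle n (kagogOf N m) (s + q) q (s≤s z≤n) (m≤n+m q s)
           (columnRow≤ s<L (≤-reflexive (+mirror-suc≡ N L c≤N))) ⟩
    countAtMost (column m (mirror N q)) q (N ∸ (s + q))
      ≡⟨ cong₂ (λ c' t → countAtMost (column m c') q t)
               (mirror-involutive N c 1≤c c≤N) N∸[s+q]≡ ⟩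
    countAtMost (column m c) q (L ∸ s) ∎
    where
    N∸[s+q]≡ : N ∸ (s + q) ≡ L ∸ s
    N∸[s+q]≡ = begin
      N ∸ (s + q)    ≡⟨ cong (N ∸_) (+-comm s q) ⟩
      N ∸ (q + s)    ≡⟨ sym (∸-+-assoc N q s) ⟩
      N ∸ q ∸ s      ≡⟨ cong (_∸ s) (∸-mirror N c 1≤c c≤N) ⟩
      L ∸ s          ∎

kagogOf-magogOf : ∀ {n} (K : Tri n) → IsKagog (suc n) K →
  ∀ p q → 1 ≤ q → q ≤ p → p ≤ n →
  kagogOf (suc n) (entry (triangle (suc n) (magogOf (suc n) (entry K)))) p q ≡ entry K p q
kagogOf-magogOf {n} K kagog p q 1≤q q≤p p≤n = begin
  countAtMost (column m c) q (N ∸ p)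
    ≡⟨ count-cong _ _ q (λ r r<q → cong (_≤ᵇ N ∸ p) (magogColumn r r<q)) ⟩
  countAtMost (λ r → suc (countAtMost (column k q) L r)) q (N ∸ p)
    ≡⟨ cong (countAtMost _ q) N∸p≡ ⟩
  countAtMost (λ r → suc (countAtMost (column k q) L r)) q (L ∸ (p ∸ q))
    ≡⟨ countAtMost-conjugate-decreasing (column k q) q L
         (KagogColumns.bounded K kagog q L 1≤q L+q≤) (KagogColumns.antitone K kagog q L 1≤q L+q≤)
         (p ∸ q) (∸-monoˡ-< (s≤s p≤n) q≤p) ⟩
  k (p ∸ q + q) q
    ≡⟨ cong (λ r → k r q) (m∸n+n≡m q≤p) ⟩
  k p q ∎
  where
  open ≡-Reasoning
  N = suc n
  k = entry K
  m = entry (triangle N (magogOf N k))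
  c = mirror N q
  L = N ∸ q
  q≤N = ≤-trans q≤p (m≤n⇒m≤1+n p≤n)
  L+q≤ : L + q ≤ N
  L+q≤ = ≤-reflexive (m∸n+n≡m q≤N)
  N∸p≡ : N ∸ p ≡ L ∸ (p ∸ q)
  N∸p≡ = trans (cong (N ∸_) (sym (m+[n∸m]≡n q≤p))) (sym (∸-+-assoc N q (p ∸ q)))
  magogColumn : ∀ r → r < q → column m c r ≡ suc (countAtMost (column k q) L r)
  magogColumn r r<q = begin
    m (r + c) c
      ≡⟨ entry-triangle N (magogOf N k) (r + c) c (s≤s z≤n) (m≤n+m c r)
           (columnRow≤ r<q (≤-reflexive (trans (+-comm q c) (mirror+≡ N q q≤N)))) ⟩
    suc (countAtMost (column k (mirror N c)) L (r + c ∸ c))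
      ≡⟨ cong₂ (λ q' t → suc (countAtMost (column k q') L t))
               (mirror-involutive N q 1≤q q≤N) (m+n∸n≡m r c) ⟩
    suc (countAtMost (column k q) L r) ∎

mainTheorem5 : (n : ℕ) → 1 ≤ n →
    Σ (Magog n → Kagog n) λ f → Σ (Kagog n → Magog n) λ g →
      (∀ m → proj₁ (g (f m)) ≡ proj₁ m) × (∀ k → proj₁ (f (g k)) ≡ proj₁ k)
mainTheorem5 (suc n) _ = toKagog , toMagog , magog-roundtrip , kagog-roundtrip
  where
  toKagog : Magog (suc n) → Kagog (suc n)
  toKagog (M , magog) = triangle n (kagogOf (suc n) (entry M)) , kagogOf-isKagog M magog
  toMagog : Kagog (suc n) → Magog (suc n)
  toMagog (K , kagog) = triangle (suc n) (magogOf (suc n) (entry K)) , magogOf-isMagog K kagog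
  magog-roundtrip : ∀ M → proj₁ (toMagog (toKagog M)) ≡ proj₁ M
  magog-roundtrip (M , magog) = triangle-≡ (suc n) _ M (magogOf-kagogOf M magog)
  kagog-roundtrip : ∀ K → proj₁ (toKagog (toMagog K)) ≡ proj₁ K
  kagog-roundtrip (K , kagog) = triangle-≡ n _ K (kagogOf-magogOf K kagog)
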